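{- For every tree $T$ of order $n \ge 3$, $$\operatorname{irr}(T) > n \operatorname{Var}(T).$$
   Context: For a graph $G=(V,E)$ of order $n$ and size $m$, $d(u)$ denotes the degree of a vertex $u$. The (Albertson) irregularity is $\operatorname{irr}(G)=\sum_{uv\in E(G)}|d(u)-d(v)|$. The degree variance is $\operatorname{Var}(G)=\frac{1}{n}\sum_{u\in V(G)}(d(u)-\overline{d})^2$, where $\overline{d}=\frac{2m}{n}$ is the average degree. -}

module Defs where

open import Data.Bool using (Bool; true; false; T; _∧_; if_then_else_)
open import Data.Nat as ℕ using (ℕ; zero; suc; ∣_-_∣; _<ᵇ_)
open import Data.Fin using (Fin; toℕ)
open import Data.List using (List; []; _∷_; _++_; [_]; map; length; foldr)
open import Data.Nat.ListAction using (sum)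
open import Data.List.Relation.Unary.Linked using (Linked)
open import Data.List.Relation.Unary.Unique.Propositional using (Unique)
open import Data.Product using (Σ; _×_)
open import Data.Empty using (⊥)

open import Data.List using (allFin) public
open import Data.Integer using (+_)
open import Data.Rational using (ℚ; _/_; _*_; _+_; _-_; 0ℚ)
open import Relation.Binary.PropositionalEquality using (_≡_)
open import Relation.Nullary using (¬_)

record Graph (n : ℕ) : Set where
  field
    adj    : Fin n → Fin n → Bool
    sym    : ∀ u v → adj u v ≡ adj v u
    irrefl : ∀ u → adj u u ≡ false
open Graph public

module _ {n : ℕ} (G : Graph n) where

  Adj : Fin n → Fin n → Set
  Adj u v = T (adj G u v)

  data Walk : Fin n → Fin n → Set where
    here : ∀ {u} → Walk u u
    step : ∀ {u w v} → Adj u w → Walk w v → Walk u v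

  Connected : Set
  Connected = ∀ u v → Walk u v

  IsCycle : Fin n → List (Fin n) → Set
  IsCycle v vs = (2 ℕ.≤ length vs) × Unique (v ∷ vs) × Linked Adj (v ∷ vs ++ [ v ])

  Acyclic : Set
  Acyclic = ∀ v vs → ¬ IsCycle v vs

  IsTree : Set
  IsTree = Connected × Acyclic

  ΣV : (Fin n → ℕ) → ℕ
  ΣV f = sum (map f (allFin n))

  deg : Fin n → ℕ
  deg u = ΣV (λ w → if adj G u w then 1 else 0)

  size : ℕ
  size = ΣV (λ u → ΣV (λ v → if adj G u v ∧ (toℕ u <ᵇ toℕ v) then 1 else 0))

  irr : ℕ
  irr = ΣV (λ u → ΣV (λ v → if adj G u v ∧ (toℕ u <ᵇ toℕ v) then ∣ deg u - deg v ∣ else 0))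

ΣQ : ∀ {n} → (Fin n → ℚ) → ℚ
ΣQ {n} f = foldr _+_ 0ℚ (map f (allFin n))

-- degree variance (1/n) Σ (d(u) - 2m/n)^2 ; (defined as 0 for the empty graph)
Var : ∀ {n} → Graph n → ℚ
Var {zero} G = 0ℚ
Var {suc k} G =
  (+ 1 / suc k) * ΣQ (λ u → let x = (+ deg G u / 1) - (+ (2 ℕ.* size G) / suc k) in x * x)

-- Write d for the degree and m for the size, so that m = n - 1. Since n Var = Σ d² - (2m)²/n
-- and Σ d² = Σ_{uv ∈ E} (d u + d v) = irr + 2 Σ_{uv ∈ E} min (d u) (d v), the claim amounts to
-- n Σ_{uv ∈ E} min (d u) (d v) < 2m². Root the tree at a vertex r of degree at least 2, which
-- exists as n ≥ 3, and charge each edge to its endpoint farther from r, whose degree bounds the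
-- minimum: Σ_{uv ∈ E} min (d u) (d v) ≤ Σ_{u ≠ r} d u = 2m - d r ≤ 2m - 2 < 2m² / n.
-- The charging is justified by repeatedly deleting a pendant vertex other than r.

module Submission where

import Data.Nat.Properties as ℕₚ
open import Algebra.Properties.Semiring.Sum ℕₚ.+-*-semiring
  using (sum; sum-syntax; sum-cong-≗; ∑-distrib-+; ∑-comm; *-distribˡ-sum; sum-replicate-zero)
open import Data.Bool using (Bool; true; false; T; _∧_; if_then_else_)
open import Data.Bool.Properties using (T?)
open import Data.Empty using (⊥-elim)
open import Data.Fin.Properties using (any?; toℕ-injective)
open import Data.Product using (∃; ∃₂; _×_; _,_; proj₂)
open import Data.Fin as Fin using (Fin; zero; suc; toℕ)
open import Data.List using (List; []; _∷_; _++_; [_]; map; foldr; length; tabulate)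
open import Data.List.Properties using (map-tabulate; length-tabulate)
open import Data.List.Membership.Propositional using (_∈_; _∉_)
open import Data.List.Relation.Unary.All as All using (All; []; _∷_)
open import Data.List.Relation.Unary.All.Properties using (¬Any⇒All¬)
open import Data.List.Relation.Unary.AllPairs as AllPairs using ([]; _∷_)
open import Data.List.Relation.Unary.Any using (here; there)
open import Data.List.Relation.Unary.Linked as Linked using (Linked; [-]; _∷_)
open import Data.List.Relation.Unary.Unique.Propositional using (Unique)
import Data.Nat.ListAction as List
open import Data.Nat using (ℕ; zero; suc; _+_; _*_; _≤_; _<_; z≤n; s≤s; s≤s⁻¹; _<ᵇ_; _⊓_; ∣_-_∣)
open import Data.Nat.Coprimality using (1-coprimeTo) renaming (sym to coprime-sym)
open import Data.Integer as ℤ using (+_)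
import Data.Integer.Properties as ℤₚ
open import Data.Rational as ℚ using (ℚ; mkℚ; _/_; 0ℚ; 1ℚ)
import Data.Rational.Properties as ℚₚ
open import Data.Rational.Solver using (module +-*-Solver)
open +-*-Solver using (solve; _:=_; _:+_; _:*_; _:-_; con)
open import Data.Nat.Tactic.RingSolver using (solve-∀)
open import Function using (_∘_; id; flip)
open import Relation.Nullary using (Dec; does; yes; no; ¬_; ¬?; _×-dec_)
open import Relation.Binary.PropositionalEquality
  using (_≡_; _≢_; refl; sym; trans; cong; cong₂; subst; subst₂; module ≡-Reasoning)

open import Defs hiding (sym)

-- Sums over Fin n

sum-allFin : ∀ {n} (f : Fin n → ℕ) → List.sum (map f (allFin n)) ≡ sum f
sum-allFin f = trans (cong List.sum (map-tabulate id f)) (sum-tabulate f)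
  where
  sum-tabulate : ∀ {n} (f : Fin n → ℕ) → List.sum (tabulate f) ≡ sum f
  sum-tabulate {zero}  f = refl
  sum-tabulate {suc n} f = cong (_+_ (f zero)) (sum-tabulate (f ∘ suc))

∑-mono-≤ : ∀ {n} {f g : Fin n → ℕ} → (∀ i → f i ≤ g i) → sum f ≤ sum g
∑-mono-≤ {zero}  f≤g = z≤n
∑-mono-≤ {suc n} f≤g = ℕₚ.+-mono-≤ (f≤g zero) (∑-mono-≤ (f≤g ∘ suc))

∑-one : ∀ n → ∑[ i < n ] 1 ≡ n
∑-one zero    = refl
∑-one (suc n) = cong suc (∑-one n)

∑-zero : ∀ {n} {f : Fin n → ℕ} → (∀ i → f i ≡ 0) → sum f ≡ 0
∑-zero {n} f≗0 = trans (sum-cong-≗ f≗0) (sum-replicate-zero n)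

pointMass : ∀ {n} → Fin n → ℕ → Fin n → ℕ
pointMass a c i = if does (i Fin.≟ a) then c else 0

∑-pointMass : ∀ {n} (a : Fin n) (c : ℕ) → sum (pointMass a c) ≡ c
∑-pointMass {suc n} zero    c = trans (cong (_+_ c) (sum-replicate-zero n)) (ℕₚ.+-identityʳ c)
∑-pointMass {suc n} (suc a) c = ∑-pointMass a c

-- Variance

ι : ℕ → ℚ
ι a = + a / 1

ι≡mkℚ : ∀ a → ι a ≡ mkℚ (+ a) 0 (coprime-sym (1-coprimeTo a))
ι≡mkℚ a = ℚₚ.normalize-coprime _

ι-+ : ∀ a b → ι (a + b) ≡ ι a ℚ.+ ι b
ι-+ a b rewrite ι≡mkℚ a | ι≡mkℚ b =
  ℚₚ./-cong (trans (ℤₚ.pos-+ a b) (sym (cong₂ ℤ._+_ (ℤₚ.*-identityʳ (+ a)) (ℤₚ.*-identityʳ (+ b)))))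
            refl

ι-* : ∀ a b → ι (a * b) ≡ ι a ℚ.* ι b
ι-* a b rewrite ι≡mkℚ a | ι≡mkℚ b = ℚₚ./-cong (ℤₚ.pos-* a b) refl

ι-mono-< : ∀ {a b} → a < b → ι a ℚ.< ι b
ι-mono-< {a} {b} a<b rewrite ι≡mkℚ a | ι≡mkℚ b =
  ℚ.*<* (subst₂ ℤ._<_ (sym (ℤₚ.*-identityʳ (+ a))) (sym (ℤₚ.*-identityʳ (+ b))) (ℤ.+<+ a<b))

ι-nonNeg : ∀ a → ℚ.NonNegative (ι a)
ι-nonNeg a rewrite ι≡mkℚ a = _

a/n≡a*1/n : ∀ a k → + a / suc k ≡ ι a ℚ.* (+ 1 / suc k)
a/n≡a*1/n a k rewrite ι≡mkℚ a | ℚₚ.normalize-coprime {1} {k} (1-coprimeTo (suc k)) =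
  ℚₚ./-cong (sym (ℤₚ.*-identityʳ (+ a))) (sym (ℕₚ.+-identityʳ (suc k)))

n*1/n≡1 : ∀ k → ι (suc k) ℚ.* (+ 1 / suc k) ≡ 1ℚ
n*1/n≡1 k rewrite ι≡mkℚ (suc k) | ℚₚ.normalize-coprime {1} {k} (1-coprimeTo (suc k)) =
  ℚₚ.*-inverseʳ (mkℚ (+ suc k) 0 (coprime-sym (1-coprimeTo (suc k))))

+-cancelʳ-< : ∀ {p q} r → p ℚ.+ r ℚ.< q ℚ.+ r → p ℚ.< q
+-cancelʳ-< {p} {q} r p+r<q+r = subst₂ ℚ._<_ (p+r-r≡p p r) (p+r-r≡p q r) (ℚₚ.+-monoˡ-< (ℚ.- r) p+r<q+r)
  where
  p+r-r≡p : ∀ p r → p ℚ.+ r ℚ.- r ≡ p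
  p+r-r≡p = solve 2 (λ p r → p :+ r :- r := p) refl

sum-of-squared-deviations : ∀ {A : Set} (xs : List A) (x : A → ℕ) (c : ℚ) →
  foldr ℚ._+_ 0ℚ (map (λ u → (ι (x u) ℚ.- c) ℚ.* (ι (x u) ℚ.- c)) xs)
  ≡ ι (List.sum (map (λ u → x u * x u) xs)) ℚ.- (c ℚ.+ c) ℚ.* ι (List.sum (map x xs))
    ℚ.+ ι (length xs) ℚ.* (c ℚ.* c)
sum-of-squared-deviations [] x c =
  solve 1 (λ c → con 0ℚ := con 0ℚ :- (c :+ c) :* con 0ℚ :+ con 0ℚ :* (c :* c)) refl c
sum-of-squared-deviations (u ∷ xs) x c
  rewrite sum-of-squared-deviations xs x c
        | ι-+ (x u * x u) (List.sum (map (λ u → x u * x u) xs)) | ι-* (x u) (x u)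
        | ι-+ (x u) (List.sum (map x xs)) | ι-+ 1 (length xs) =
  solve 5 (λ y c Q S L → (y :- c) :* (y :- c) :+ (Q :- (c :+ c) :* S :+ L :* (c :* c))
                       := (y :* y :+ Q) :- (c :+ c) :* (y :+ S) :+ (con 1ℚ :+ L) :* (c :* c))
    refl (ι (x u)) c (ι (List.sum (map (λ u → x u * x u) xs))) (ι (List.sum (map x xs))) (ι (length xs))

ΣQ-squared-deviations : ∀ {n} (x : Fin n → ℕ) (c : ℚ) →
  ΣQ (λ u → (ι (x u) ℚ.- c) ℚ.* (ι (x u) ℚ.- c))
  ≡ ι (∑[ u < n ] (x u * x u)) ℚ.- (c ℚ.+ c) ℚ.* ι (sum x) ℚ.+ ι n ℚ.* (c ℚ.* c)
ΣQ-squared-deviations {n} x c = begin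
  ΣQ (λ u → (ι (x u) ℚ.- c) ℚ.* (ι (x u) ℚ.- c))
    ≡⟨ sum-of-squared-deviations (allFin n) x c ⟩
  ι (List.sum (map (λ u → x u * x u) (allFin n))) ℚ.- (c ℚ.+ c) ℚ.* ι (List.sum (map x (allFin n)))
    ℚ.+ ι (length (allFin n)) ℚ.* (c ℚ.* c)
    ≡⟨ cong₂ (λ q t → ι q ℚ.- (c ℚ.+ c) ℚ.* ι t ℚ.+ ι (length (allFin n)) ℚ.* (c ℚ.* c))
             (sum-allFin (λ u → x u * x u)) (sum-allFin x) ⟩
  ι (∑[ u < n ] (x u * x u)) ℚ.- (c ℚ.+ c) ℚ.* ι (sum x) ℚ.+ ι (length (allFin n)) ℚ.* (c ℚ.* c)
    ≡⟨ cong (λ l → ι (∑[ u < n ] (x u * x u)) ℚ.- (c ℚ.+ c) ℚ.* ι (sum x) ℚ.+ ι l ℚ.* (c ℚ.* c))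
            (length-tabulate {n = n} id) ⟩
  ι (∑[ u < n ] (x u * x u)) ℚ.- (c ℚ.+ c) ℚ.* ι (sum x) ℚ.+ ι n ℚ.* (c ℚ.* c) ∎
  where open ≡-Reasoning

-- Var G for a graph G on Fin (suc k) unfolds to meanSqDeviation k (deg G) (2 * size G).
meanSqDeviation : ∀ k → (Fin (suc k) → ℕ) → ℕ → ℚ
meanSqDeviation k x t =
  (+ 1 / suc k) ℚ.* ΣQ (λ u → (ι (x u) ℚ.- + t / suc k) ℚ.* (ι (x u) ℚ.- + t / suc k))

n*n*meanSqDeviation : ∀ k (x : Fin (suc k) → ℕ) {t} → sum x ≡ t →
  ι (suc k) ℚ.* (ι (suc k) ℚ.* meanSqDeviation k x t) ℚ.+ ι (t * t)
  ≡ ι (suc k * ∑[ u < suc k ] (x u * x u))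
n*n*meanSqDeviation k x refl = begin
  N ℚ.* (N ℚ.* (s ℚ.* ΣQ (λ u → (ι (x u) ℚ.- c) ℚ.* (ι (x u) ℚ.- c)))) ℚ.+ ι (sum x * sum x)
    ≡⟨ cong₂ (λ e f → N ℚ.* (N ℚ.* (s ℚ.* e)) ℚ.+ f) expand (ι-* (sum x) (sum x)) ⟩
  N ℚ.* (N ℚ.* (s ℚ.* D)) ℚ.+ S ℚ.* S
    ≡⟨ identity N s Q S ⟩
  N ℚ.* Q ℚ.+ (N ℚ.* s ℚ.- 1ℚ) ℚ.* R
    ≡⟨ cong (λ e → N ℚ.* Q ℚ.+ (e ℚ.- 1ℚ) ℚ.* R) (n*1/n≡1 k) ⟩
  N ℚ.* Q ℚ.+ 0ℚ ℚ.* R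
    ≡⟨ trans (cong (ℚ._+_ (N ℚ.* Q)) (ℚₚ.*-zeroˡ R)) (ℚₚ.+-identityʳ (N ℚ.* Q)) ⟩
  N ℚ.* Q
    ≡⟨ sym (ι-* (suc k) (∑[ u < suc k ] (x u * x u))) ⟩
  ι (suc k * ∑[ u < suc k ] (x u * x u)) ∎
  where
  open ≡-Reasoning
  N = ι (suc k)
  s = + 1 / suc k
  S = ι (sum x)
  Q = ι (∑[ u < suc k ] (x u * x u))
  c = + sum x / suc k
  D = Q ℚ.- (S ℚ.* s ℚ.+ S ℚ.* s) ℚ.* S ℚ.+ N ℚ.* ((S ℚ.* s) ℚ.* (S ℚ.* s))
  R = N ℚ.* Q ℚ.+ S ℚ.* S ℚ.* ((N ℚ.* s) ℚ.* (N ℚ.* s) ℚ.- N ℚ.* s ℚ.- 1ℚ)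
  expand : ΣQ (λ u → (ι (x u) ℚ.- c) ℚ.* (ι (x u) ℚ.- c)) ≡ D
  expand = trans (ΣQ-squared-deviations x c)
                 (cong (λ c → Q ℚ.- (c ℚ.+ c) ℚ.* S ℚ.+ N ℚ.* (c ℚ.* c)) (a/n≡a*1/n (sum x) k))
  -- The solver cannot use N * s = 1, so the identity carries a multiple of N * s - 1.
  identity : ∀ N s Q S →
    N ℚ.* (N ℚ.* (s ℚ.* (Q ℚ.- (S ℚ.* s ℚ.+ S ℚ.* s) ℚ.* S ℚ.+ N ℚ.* ((S ℚ.* s) ℚ.* (S ℚ.* s))))) ℚ.+ S ℚ.* S
    ≡ N ℚ.* Q ℚ.+ (N ℚ.* s ℚ.- 1ℚ) ℚ.* (N ℚ.* Q ℚ.+ S ℚ.* S ℚ.* ((N ℚ.* s) ℚ.* (N ℚ.* s) ℚ.- N ℚ.* s ℚ.- 1ℚ))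
  identity = solve 4 (λ N s Q S →
    N :* (N :* (s :* (Q :- (S :* s :+ S :* s) :* S :+ N :* ((S :* s) :* (S :* s))))) :+ S :* S
    := N :* Q :+ (N :* s :- con 1ℚ) :* (N :* Q :+ S :* S :* ((N :* s) :* (N :* s) :- N :* s :- con 1ℚ))) refl

n*meanSqDeviation< : ∀ k (x : Fin (suc k) → ℕ) {t} i → sum x ≡ t →
  suc k * ∑[ u < suc k ] (x u * x u) < suc k * i + t * t →
  ι (suc k) ℚ.* meanSqDeviation k x t ℚ.< ι i
n*meanSqDeviation< k x {t} i Σx≡t n*Σx²<n*i+t² =
  ℚₚ.*-cancelˡ-<-nonNeg N {{ι-nonNeg (suc k)}} (+-cancelʳ-< (ι (t * t)) (begin-strict
    N ℚ.* (N ℚ.* meanSqDeviation k x t) ℚ.+ ι (t * t) ≡⟨ n*n*meanSqDeviation k x Σx≡t ⟩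
    ι (suc k * ∑[ u < suc k ] (x u * x u))           <⟨ ι-mono-< n*Σx²<n*i+t² ⟩
    ι (suc k * i + t * t)                            ≡⟨ ι-+ (suc k * i) (t * t) ⟩
    ι (suc k * i) ℚ.+ ι (t * t)                      ≡⟨ cong (ℚ._+ ι (t * t)) (ι-* (suc k) i) ⟩
    N ℚ.* ι i ℚ.+ ι (t * t)                          ∎))
  where
  open ℚₚ.≤-Reasoning
  N = ι (suc k)

-- Edge sums and degrees

if-split-<ᵇ : ∀ {a b} (x : ℕ) → a ≢ b → x ≡ (if a <ᵇ b then x else 0) + (if b <ᵇ a then x else 0)
if-split-<ᵇ {a} {b} x a≢b with a <ᵇ b in a<ᵇb | b <ᵇ a in b<ᵇa
... | true  | true  = ⊥-elim (ℕₚ.<-asym (ℕₚ.<ᵇ⇒< a b (subst T (sym a<ᵇb) _))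
                                        (ℕₚ.<ᵇ⇒< b a (subst T (sym b<ᵇa) _)))
... | true  | false = sym (ℕₚ.+-identityʳ x)
... | false | true  = refl
... | false | false = ⊥-elim (a≢b (ℕₚ.≤-antisym (ℕₚ.≮⇒≥ (≮ b<ᵇa)) (ℕₚ.≮⇒≥ (≮ a<ᵇb))))
  where
  ≮ : ∀ {c d} → (c <ᵇ d) ≡ false → ¬ c < d
  ≮ c≮d c<d = subst T c≮d (ℕₚ.<⇒<ᵇ c<d)

if-+ : ∀ (b : Bool) (x y : ℕ) → (if b then x + y else 0) ≡ (if b then x else 0) + (if b then y else 0)
if-+ true  x y = refl
if-+ false x y = refl

m+n≡∣m-n∣+[m⊓n+m⊓n] : ∀ m n → m + n ≡ ∣ m - n ∣ + (m ⊓ n + m ⊓ n)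
m+n≡∣m-n∣+[m⊓n+m⊓n] zero    n       = sym (ℕₚ.+-identityʳ n)
m+n≡∣m-n∣+[m⊓n+m⊓n] (suc m) zero    = refl
m+n≡∣m-n∣+[m⊓n+m⊓n] (suc m) (suc n) = begin
  suc m + suc n                                 ≡⟨ cong suc (ℕₚ.+-suc m n) ⟩
  suc (suc (m + n))                             ≡⟨ cong (λ k → suc (suc k)) (m+n≡∣m-n∣+[m⊓n+m⊓n] m n) ⟩
  suc (suc (∣ m - n ∣ + (m ⊓ n + m ⊓ n)))       ≡⟨ shift ∣ m - n ∣ (m ⊓ n) ⟩
  ∣ m - n ∣ + (suc (m ⊓ n) + suc (m ⊓ n))       ∎
  where
  open ≡-Reasoning
  shift : ∀ d k → suc (suc (d + (k + k))) ≡ d + (suc k + suc k)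
  shift = solve-∀

module _ {n : ℕ} (G : Graph n) where

  Adj-sym : ∀ {u v} → Adj G u v → Adj G v u
  Adj-sym {u} {v} = subst T (Graph.sym G u v)

  Adj-irrefl : ∀ {u v} → Adj G u v → u ≢ v
  Adj-irrefl {u} uv refl = subst T (Graph.irrefl G u) uv

  -- arcSum counts every edge in both directions, edgeSum once, as size and irr do.
  arcTerm : (Fin n → Fin n → ℕ) → Fin n → Fin n → ℕ
  arcTerm h u v = if adj G u v then h u v else 0

  edgeTerm : (Fin n → Fin n → ℕ) → Fin n → Fin n → ℕ
  edgeTerm h u v = if adj G u v ∧ (toℕ u <ᵇ toℕ v) then h u v else 0

  arcSum edgeSum : (Fin n → Fin n → ℕ) → ℕ
  arcSum  h = ∑[ u < n ] ∑[ v < n ] arcTerm h u v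
  edgeSum h = ∑[ u < n ] ∑[ v < n ] edgeTerm h u v

  arcTerm-split : ∀ h u v → arcTerm h u v ≡ edgeTerm h u v + edgeTerm (flip h) v u
  arcTerm-split h u v rewrite Graph.sym G v u with adj G u v in uv
  ... | false = refl
  ... | true  = if-split-<ᵇ (h u v) (Adj-irrefl (subst T (sym uv) _) ∘ toℕ-injective)

  arcSum≡edgeSum+edgeSum : ∀ h → arcSum h ≡ edgeSum h + edgeSum (flip h)
  arcSum≡edgeSum+edgeSum h = begin
    arcSum h
      ≡⟨ sum-cong-≗ (λ u → trans (sum-cong-≗ (arcTerm-split h u)) (∑-distrib-+ (edgeTerm h u) _)) ⟩
    ∑[ u < n ] (∑[ v < n ] edgeTerm h u v + ∑[ v < n ] edgeTerm (flip h) v u)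
      ≡⟨ ∑-distrib-+ (λ u → ∑[ v < n ] edgeTerm h u v) _ ⟩
    edgeSum h + ∑[ u < n ] ∑[ v < n ] edgeTerm (flip h) v u
      ≡⟨ cong (_+_ (edgeSum h)) (∑-comm (λ u v → edgeTerm (flip h) v u)) ⟩
    edgeSum h + edgeSum (flip h) ∎
    where open ≡-Reasoning

  edgeSum-+ : ∀ h h′ → edgeSum (λ u v → h u v + h′ u v) ≡ edgeSum h + edgeSum h′
  edgeSum-+ h h′ = begin
    edgeSum (λ u v → h u v + h′ u v)
      ≡⟨ sum-cong-≗ (λ u → trans (sum-cong-≗ (λ v → if-+ (adj G u v ∧ (toℕ u <ᵇ toℕ v)) (h u v) (h′ u v)))
                                (∑-distrib-+ (edgeTerm h u) (edgeTerm h′ u))) ⟩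
    ∑[ u < n ] (∑[ v < n ] edgeTerm h u v + ∑[ v < n ] edgeTerm h′ u v)
      ≡⟨ ∑-distrib-+ (λ u → ∑[ v < n ] edgeTerm h u v) _ ⟩
    edgeSum h + edgeSum h′ ∎
    where open ≡-Reasoning

  edgeSum-cong : ∀ {h h′} → (∀ u v → h u v ≡ h′ u v) → edgeSum h ≡ edgeSum h′
  edgeSum-cong h≗h′ =
    sum-cong-≗ (λ u → sum-cong-≗ (λ v →
      cong (λ x → if adj G u v ∧ (toℕ u <ᵇ toℕ v) then x else 0) (h≗h′ u v)))

module _ {n : ℕ} (G : Graph n) where

  deg≡arcRow : ∀ u → deg G u ≡ ∑[ v < n ] arcTerm G (λ _ _ → 1) u v
  deg≡arcRow u = sum-allFin (arcTerm G (λ _ _ → 1) u)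

  ΣV²≡∑∑ : (F : Fin n → Fin n → ℕ) → ΣV G (λ u → ΣV G (F u)) ≡ ∑[ u < n ] ∑[ v < n ] F u v
  ΣV²≡∑∑ F = trans (sum-allFin (λ u → ΣV G (F u))) (sum-cong-≗ (λ u → sum-allFin (F u)))

  size≡edgeSum : size G ≡ edgeSum G (λ _ _ → 1)
  size≡edgeSum = ΣV²≡∑∑ (edgeTerm G (λ _ _ → 1))

  irr≡edgeSum : irr G ≡ edgeSum G (λ u v → ∣ deg G u - deg G v ∣)
  irr≡edgeSum = ΣV²≡∑∑ (edgeTerm G (λ u v → ∣ deg G u - deg G v ∣))

  ∑deg≡arcCount : ∑[ u < n ] deg G u ≡ arcSum G (λ _ _ → 1)
  ∑deg≡arcCount = sum-cong-≗ deg≡arcRow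

  handshake : ∑[ u < n ] deg G u ≡ 2 * size G
  handshake = begin
    ∑[ u < n ] deg G u                            ≡⟨ ∑deg≡arcCount ⟩
    arcSum G (λ _ _ → 1)                          ≡⟨ arcSum≡edgeSum+edgeSum G (λ _ _ → 1) ⟩
    edgeSum G (λ _ _ → 1) + edgeSum G (λ _ _ → 1) ≡⟨ cong₂ _+_ (sym size≡edgeSum) (sym size≡edgeSum) ⟩
    size G + size G                               ≡⟨ cong (_+_ (size G)) (sym (ℕₚ.+-identityʳ (size G))) ⟩
    2 * size G                                    ∎
    where open ≡-Reasoning

  ∑deg²≡arcSum-deg : ∑[ u < n ] (deg G u * deg G u) ≡ arcSum G (λ u _ → deg G u)
  ∑deg²≡arcSum-deg = sum-cong-≗ (λ u → begin
    deg G u * deg G u                                  ≡⟨ cong (deg G u *_) (deg≡arcRow u) ⟩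
    deg G u * ∑[ v < n ] arcTerm G (λ _ _ → 1) u v     ≡⟨ *-distribˡ-sum (deg G u) (arcTerm G (λ _ _ → 1) u) ⟩
    ∑[ v < n ] (deg G u * arcTerm G (λ _ _ → 1) u v)   ≡⟨ sum-cong-≗ (λ v → *-indicator (adj G u v) (deg G u)) ⟩
    ∑[ v < n ] arcTerm G (λ u _ → deg G u) u v         ∎)
    where
    open ≡-Reasoning
    *-indicator : ∀ b x → x * (if b then 1 else 0) ≡ (if b then x else 0)
    *-indicator true  x = ℕₚ.*-identityʳ x
    *-indicator false x = ℕₚ.*-zeroʳ x

  arcSum-deg≡irr+arcSum-⊓ : arcSum G (λ u _ → deg G u) ≡ irr G + arcSum G (λ u v → deg G u ⊓ deg G v)
  arcSum-deg≡irr+arcSum-⊓ = begin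
    arcSum G (λ u _ → d u)
      ≡⟨ arcSum≡edgeSum+edgeSum G (λ u _ → d u) ⟩
    edgeSum G (λ u _ → d u) + edgeSum G (λ _ v → d v)
      ≡⟨ sym (edgeSum-+ G (λ u _ → d u) (λ _ v → d v)) ⟩
    edgeSum G (λ u v → d u + d v)
      ≡⟨ edgeSum-cong G (λ u v → m+n≡∣m-n∣+[m⊓n+m⊓n] (d u) (d v)) ⟩
    edgeSum G (λ u v → ∣ d u - d v ∣ + (d u ⊓ d v + d u ⊓ d v))
      ≡⟨ edgeSum-+ G (λ u v → ∣ d u - d v ∣) (λ u v → d u ⊓ d v + d u ⊓ d v) ⟩
    edgeSum G (λ u v → ∣ d u - d v ∣) + edgeSum G (λ u v → d u ⊓ d v + d u ⊓ d v)
      ≡⟨ cong₂ _+_ (sym irr≡edgeSum) (edgeSum-+ G min min) ⟩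
    irr G + (edgeSum G min + edgeSum G min)
      ≡⟨ cong (λ e → irr G + (edgeSum G min + e)) (edgeSum-cong G (λ u v → ℕₚ.⊓-comm (d u) (d v))) ⟩
    irr G + (edgeSum G min + edgeSum G (flip min))
      ≡⟨ cong (_+_ (irr G)) (sym (arcSum≡edgeSum+edgeSum G min)) ⟩
    irr G + arcSum G min ∎
    where
    open ≡-Reasoning
    d = deg G
    min : Fin n → Fin n → ℕ
    min u v = d u ⊓ d v

-- Pendant vertices

-- Deleting a vertex would change the vertex type Fin n, so a vertex is removed by deleting its edges.
isolate : ∀ {n} → Graph n → Fin n → Graph n
isolate {n} H ℓ = record { adj = adj′ ; sym = sym′ ; irrefl = irrefl′ }
  where
  adj′ : Fin n → Fin n → Bool
  adj′ u v = if does (u Fin.≟ ℓ) then false else if does (v Fin.≟ ℓ) then false else adj H u v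
  sym′ : ∀ u v → adj′ u v ≡ adj′ v u
  sym′ u v with u Fin.≟ ℓ | v Fin.≟ ℓ
  ... | yes _ | yes _ = refl
  ... | yes _ | no  _ = refl
  ... | no  _ | yes _ = refl
  ... | no  _ | no  _ = Graph.sym H u v
  irrefl′ : ∀ u → adj′ u u ≡ false
  irrefl′ u with u Fin.≟ ℓ
  ... | yes _ = refl
  ... | no  _ = Graph.irrefl H u

module _ {n : ℕ} (H : Graph n) (ℓ : Fin n) where

  isolate-⊆ : ∀ {u v} → Adj (isolate H ℓ) u v → Adj H u v
  isolate-⊆ {u} {v} uv with u Fin.≟ ℓ | v Fin.≟ ℓ
  ... | no _ | no _ = uv

  isolate-⊇ : ∀ {u v} → u ≢ ℓ → v ≢ ℓ → Adj H u v → Adj (isolate H ℓ) u v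
  isolate-⊇ {u} {v} u≢ℓ v≢ℓ uv with u Fin.≟ ℓ | v Fin.≟ ℓ
  ... | yes u≡ℓ | _         = ⊥-elim (u≢ℓ u≡ℓ)
  ... | no _    | yes v≡ℓ   = ⊥-elim (v≢ℓ v≡ℓ)
  ... | no _    | no _      = uv

  isolate-isolates : ∀ {x} → ¬ Adj (isolate H ℓ) ℓ x
  isolate-isolates uv with ℓ Fin.≟ ℓ
  ... | no ℓ≢ℓ = ℓ≢ℓ refl

  arcTerm-isolate : ∀ h u v → arcTerm H h u v
    ≡ arcTerm (isolate H ℓ) h u v + pointMass ℓ (arcTerm H h ℓ v) u + pointMass ℓ (arcTerm H h u ℓ) v
  arcTerm-isolate h u v with u Fin.≟ ℓ | v Fin.≟ ℓ
  ... | yes refl | yes refl rewrite Graph.irrefl H ℓ = refl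
  ... | yes refl | no _     = sym (ℕₚ.+-identityʳ _)
  ... | no _     | yes refl = refl
  ... | no _     | no _     = sym (trans (ℕₚ.+-identityʳ _) (ℕₚ.+-identityʳ _))

  arcSum-isolate : ∀ h → arcSum H h
    ≡ arcSum (isolate H ℓ) h + ∑[ v < n ] arcTerm H h ℓ v + ∑[ u < n ] arcTerm H h u ℓ
  arcSum-isolate h = begin
    arcSum H h
      ≡⟨ sum-cong-≗ (λ u → trans (sum-cong-≗ (arcTerm-isolate h u)) (∑-distrib-+₃ (A u) (B u) (C u))) ⟩
    ∑[ u < n ] (∑[ v < n ] A u v + ∑[ v < n ] B u v + ∑[ v < n ] C u v)
      ≡⟨ ∑-distrib-+₃ (λ u → ∑[ v < n ] A u v) (λ u → ∑[ v < n ] B u v) (λ u → ∑[ v < n ] C u v) ⟩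
    arcSum (isolate H ℓ) h + ∑[ u < n ] ∑[ v < n ] B u v + ∑[ u < n ] ∑[ v < n ] C u v
      ≡⟨ cong₂ (λ b c → arcSum (isolate H ℓ) h + b + c)
               (trans (∑-comm B) (sum-cong-≗ (λ v → ∑-pointMass ℓ (arcTerm H h ℓ v))))
               (sum-cong-≗ (λ u → ∑-pointMass ℓ (arcTerm H h u ℓ))) ⟩
    arcSum (isolate H ℓ) h + ∑[ v < n ] arcTerm H h ℓ v + ∑[ u < n ] arcTerm H h u ℓ ∎
    where
    open ≡-Reasoning
    A B C : Fin n → Fin n → ℕ
    A = arcTerm (isolate H ℓ) h
    B u v = pointMass ℓ (arcTerm H h ℓ v) u
    C u v = pointMass ℓ (arcTerm H h u ℓ) v
    ∑-distrib-+₃ : ∀ (f g k : Fin n → ℕ) → ∑[ i < n ] (f i + g i + k i) ≡ sum f + sum g + sum k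
    ∑-distrib-+₃ f g k = trans (∑-distrib-+ (λ i → f i + g i) k) (cong (_+ sum k) (∑-distrib-+ f g))

module _ {n : ℕ} (H : Graph n) where

  firstStep : ∀ {u v} → Walk H u v → u ≢ v → ∃ (Adj H u)
  firstStep here        u≢u = ⊥-elim (u≢u refl)
  firstStep (step uw _) _   = _ , uw

  lastStep : ∀ {u v} → Walk H u v → u ≢ v → ∃ λ y → Adj H y v
  lastStep here u≢u = ⊥-elim (u≢u refl)
  lastStep {u} {v} (step {w = w} uw wv) _ with w Fin.≟ v
  ... | yes refl = u , uw
  ... | no w≢v   = lastStep wv w≢v

  Acyclic-⊆ : ∀ {H′ : Graph n} → (∀ {u v} → Adj H′ u v → Adj H u v) → Acyclic H → Acyclic H′
  Acyclic-⊆ H′⊆H acyclic v vs (length≥2 , unique , linked) =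
    acyclic v vs (length≥2 , unique , Linked.map H′⊆H linked)

  hasNeighbour? : ∀ u → Dec (∃ (Adj H u))
  hasNeighbour? u = any? (λ x → T? (adj H u x))

record Pendant {n} (H : Graph n) (ℓ p : Fin n) : Set where
  field
    adjacent : Adj H ℓ p
    unique   : ∀ {x} → Adj H ℓ x → x ≡ p

module _ {n : ℕ} {H : Graph n} {ℓ p : Fin n} (pendant : Pendant H ℓ p) where
  open Pendant pendant

  pendantRow : ∀ h → ∑[ v < n ] arcTerm H h ℓ v ≡ h ℓ p
  pendantRow h = trans (sum-cong-≗ row) (∑-pointMass p (h ℓ p))
    where
    row : ∀ v → arcTerm H h ℓ v ≡ pointMass p (h ℓ p) v
    row v with v Fin.≟ p | adj H ℓ v in ℓv
    ... | yes refl | true  = refl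
    ... | yes refl | false = ⊥-elim (subst T ℓv adjacent)
    ... | no _     | false = refl
    ... | no v≢p   | true  = ⊥-elim (v≢p (unique (subst T (sym ℓv) _)))

  pendantColumn : ∀ h → ∑[ u < n ] arcTerm H h u ℓ ≡ h p ℓ
  pendantColumn h =
    trans (sum-cong-≗ (λ u → cong (λ b → if b then h u ℓ else 0) (Graph.sym H u ℓ))) (pendantRow (flip h))

  arcSum-isolatePendant : ∀ h → arcSum H h ≡ arcSum (isolate H ℓ) h + h ℓ p + h p ℓ
  arcSum-isolatePendant h =
    trans (arcSum-isolate H ℓ h)
          (cong₂ (λ a b → arcSum (isolate H ℓ) h + a + b) (pendantRow h) (pendantColumn h))

  -- A walk through ℓ enters and leaves it via p, so the detour can be cut out.
  Walk-isolatePendant : ∀ {u v} → Walk H u v → u ≢ ℓ → v ≢ ℓ → Walk (isolate H ℓ) u v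
  Walk-isolatePendant here _ _ = here
  Walk-isolatePendant (step {w = w} uw wv) u≢ℓ v≢ℓ with w Fin.≟ ℓ
  ... | no w≢ℓ = step (isolate-⊇ H ℓ u≢ℓ w≢ℓ uw) (Walk-isolatePendant wv w≢ℓ v≢ℓ)
  Walk-isolatePendant (step _ here) _ v≢ℓ | yes refl = ⊥-elim (v≢ℓ refl)
  Walk-isolatePendant {u} (step uℓ (step {w = x} ℓx xv)) u≢ℓ v≢ℓ | yes refl =
    subst (λ y → Walk (isolate H ℓ) y _) x≡u (Walk-isolatePendant xv (u≢ℓ ∘ trans (sym x≡u)) v≢ℓ)
    where
    x≡u : x ≡ u
    x≡u = trans (unique ℓx) (sym (unique (Adj-sym H uℓ)))

module _ {A : Set} where

  prefixTo : ∀ {w : A} {xs} → w ∈ xs → List A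
  prefixTo {xs = x ∷ _} (here _)     = x ∷ []
  prefixTo {xs = x ∷ _} (there w∈xs) = x ∷ prefixTo w∈xs

  prefixTo-nonEmpty : ∀ {w : A} {xs} (w∈xs : w ∈ xs) → 1 ≤ length (prefixTo w∈xs)
  prefixTo-nonEmpty (here _)  = s≤s z≤n
  prefixTo-nonEmpty (there _) = s≤s z≤n

  All-prefixTo : ∀ {P : A → Set} {w xs} → All P xs → (w∈xs : w ∈ xs) → All P (prefixTo w∈xs)
  All-prefixTo (px ∷ _)   (here _)     = px ∷ []
  All-prefixTo (px ∷ pxs) (there w∈xs) = px ∷ All-prefixTo pxs w∈xs

  Unique-prefixTo : ∀ {w xs} → Unique xs → (w∈xs : w ∈ xs) → Unique (prefixTo w∈xs)
  Unique-prefixTo (_ ∷ _)            (here _)     = [] ∷ []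
  Unique-prefixTo (x∉xs ∷ unique-xs) (there w∈xs) = All-prefixTo x∉xs w∈xs ∷ Unique-prefixTo unique-xs w∈xs

  Linked-prefixTo : ∀ {R : A → A → Set} {w y z xs} (w∈xs : w ∈ xs) →
    Linked R (y ∷ xs) → R w z → Linked R (y ∷ prefixTo w∈xs ++ [ z ])
  Linked-prefixTo (here refl)  (Ryx ∷ _)  Rwz = Ryx ∷ Rwz ∷ [-]
  Linked-prefixTo (there w∈xs) (Ryx ∷ Rxs) Rwz = Ryx ∷ Linked-prefixTo w∈xs Rxs Rwz

module _ {n : ℕ} where
  open import Data.List.Membership.DecPropositional (Fin._≟_ {n}) using (_∈?_)

  outside : List (Fin n) → ℕ
  outside P = ∑[ x < n ] (if does (x ∈? P) then 0 else 1)

  outside-∷ : ∀ {x P} → x ∉ P → outside (x ∷ P) < outside P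
  outside-∷ {x} {P} x∉P = begin
    suc (outside (x ∷ P))                    ≡⟨ ℕₚ.+-comm 1 (outside (x ∷ P)) ⟩
    outside (x ∷ P) + 1                      ≡⟨ cong (_+_ (outside (x ∷ P))) (sym (∑-pointMass x 1)) ⟩
    outside (x ∷ P) + sum (pointMass x 1)    ≡⟨ sym (∑-distrib-+ _ (pointMass x 1)) ⟩
    ∑[ y < n ] (term (x ∷ P) y + pointMass x 1 y) ≤⟨ ∑-mono-≤ pointwise ⟩
    outside P                                ∎
    where
    open ℕₚ.≤-Reasoning
    term : List (Fin n) → Fin n → ℕ
    term Q y = if does (y ∈? Q) then 0 else 1
    pointwise : ∀ y → term (x ∷ P) y + pointMass x 1 y ≤ term P y
    pointwise y with y Fin.≟ x | y ∈? P
    ... | yes refl | yes x∈P = ⊥-elim (x∉P x∈P)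
    ... | yes refl | no _    = ℕₚ.≤-refl
    ... | no _     | yes _   = z≤n
    ... | no _     | no _    = ℕₚ.≤-refl

  module _ (H : Graph n) (acyclic : Acyclic H) (r : Fin n) where

    chord⇒cycle : ∀ {v₀ v₁ w rest} → Unique (v₀ ∷ v₁ ∷ rest) → Linked (Adj H) (v₀ ∷ v₁ ∷ rest) →
      Adj H v₀ w → (w∈rest : w ∈ rest) → IsCycle H v₀ (v₁ ∷ prefixTo w∈rest)
    chord⇒cycle unique linked v₀w w∈rest =
      s≤s (prefixTo-nonEmpty w∈rest) ,
      Unique-prefixTo unique (there (there w∈rest)) ,
      Linked-prefixTo (there w∈rest) linked (Adj-sym H v₀w)

    -- Longest-path argument: the path v₀ v₁ … (stored from its growing end v₀, and containing r)
    -- is extended at v₀ while possible; at a maximal path, v₀ is pendant.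
    pendantFrom : ∀ fuel v₀ v₁ rest → Unique (v₀ ∷ v₁ ∷ rest) → Linked (Adj H) (v₀ ∷ v₁ ∷ rest) →
      r ∈ v₁ ∷ rest → outside (v₀ ∷ v₁ ∷ rest) < fuel → ∃₂ λ ℓ p → ℓ ≢ r × Pendant H ℓ p
    pendantFrom zero _ _ _ _ _ _ ()
    pendantFrom (suc fuel) v₀ v₁ rest unique linked r∈path bound
      with any? (λ x → T? (adj H v₀ x) ×-dec ¬? (x ∈? (v₀ ∷ v₁ ∷ rest)))
    ... | yes (x , v₀x , x∉path) =
      pendantFrom fuel x v₀ (v₁ ∷ rest) (¬Any⇒All¬ _ x∉path ∷ unique) (Adj-sym H v₀x ∷ linked) (there r∈path)
        (ℕₚ.<-≤-trans (outside-∷ x∉path) (s≤s⁻¹ bound))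
    ... | no noExit = v₀ , v₁ , All.lookup (AllPairs.head unique) r∈path ,
                      record { adjacent = Linked.head linked ; unique = onlyNeighbour }
      where
      onlyNeighbour : ∀ {x} → Adj H v₀ x → x ≡ v₁
      onlyNeighbour {x} v₀x with x ∈? (v₀ ∷ v₁ ∷ rest)
      ... | yes (here refl)           = ⊥-elim (Adj-irrefl H v₀x refl)
      ... | yes (there (here x≡v₁))   = x≡v₁
      ... | yes (there (there x∈rest)) = ⊥-elim (acyclic v₀ _ (chord⇒cycle unique linked v₀x x∈rest))
      ... | no x∉path                 = ⊥-elim (noExit (x , v₀x , x∉path))

    pendant-exists : ∀ {w} → Adj H r w → ∃₂ λ ℓ p → ℓ ≢ r × Pendant H ℓ p
    pendant-exists {w} rw =
      pendantFrom (suc (outside (w ∷ r ∷ []))) w r []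
        (((Adj-irrefl H rw ∘ sym) ∷ []) ∷ [] ∷ []) (Adj-sym H rw ∷ [-]) (here refl) (ℕₚ.n<1+n _)

-- Rooted forests

module _ {n : ℕ} (r : Fin n) where

  Rooted : Graph n → Set
  Rooted H = ∀ u x → Adj H u x → Walk H u r

  -- When H is a rooted forest, the vertices other than r that carry an edge are exactly
  -- those having a parent, so childSum sums f over the children.
  childTerm : Graph n → (Fin n → ℕ) → Fin n → ℕ
  childTerm H f u = if does (u Fin.≟ r) then 0 else if does (hasNeighbour? H u) then f u else 0

  childSum : Graph n → (Fin n → ℕ) → ℕ
  childSum H f = sum (childTerm H f)

  module _ {H : Graph n} {ℓ p : Fin n} (rooted : Rooted H) (ℓ≢r : ℓ ≢ r) (pendant : Pendant H ℓ p) where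

    Rooted-isolatePendant : Rooted (isolate H ℓ)
    Rooted-isolatePendant u x ux =
      Walk-isolatePendant pendant (rooted u x (isolate-⊆ H ℓ ux)) u≢ℓ (ℓ≢r ∘ sym)
      where
      u≢ℓ : u ≢ ℓ
      u≢ℓ refl = isolate-isolates H ℓ ux

    childSum-isolatePendant : ∀ f → childSum H f ≡ childSum (isolate H ℓ) f + f ℓ
    childSum-isolatePendant f = begin
      childSum H f
        ≡⟨ sum-cong-≗ pointwise ⟩
      ∑[ u < n ] (childTerm (isolate H ℓ) f u + pointMass ℓ (f ℓ) u)
        ≡⟨ ∑-distrib-+ (childTerm (isolate H ℓ) f) (pointMass ℓ (f ℓ)) ⟩
      childSum (isolate H ℓ) f + sum (pointMass ℓ (f ℓ))
        ≡⟨ cong (_+_ (childSum (isolate H ℓ) f)) (∑-pointMass ℓ (f ℓ)) ⟩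
      childSum (isolate H ℓ) f + f ℓ ∎
      where
      open ≡-Reasoning
      pointwise : ∀ u → childTerm H f u ≡ childTerm (isolate H ℓ) f u + pointMass ℓ (f ℓ) u
      pointwise u = cases (u Fin.≟ r) (u Fin.≟ ℓ) (hasNeighbour? H u) (hasNeighbour? (isolate H ℓ) u)
        where
        cases : (u≟r : Dec (u ≡ r)) (u≟ℓ : Dec (u ≡ ℓ))
                (N : Dec (∃ (Adj H u))) (N′ : Dec (∃ (Adj (isolate H ℓ) u))) →
          (if does u≟r then 0 else if does N then f u else 0)
          ≡ (if does u≟r then 0 else if does N′ then f u else 0) + (if does u≟ℓ then f ℓ else 0)
        cases (yes refl) (yes refl) _ _ = ⊥-elim (ℓ≢r refl)
        cases (yes _) (no _) _ _ = refl
        cases (no _) (yes refl) (no noNeighbour) _ = ⊥-elim (noNeighbour (p , Pendant.adjacent pendant))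
        cases (no _) (yes refl) (yes _) (yes (_ , ℓx)) = ⊥-elim (isolate-isolates H ℓ ℓx)
        cases (no _) (yes refl) (yes _) (no _) = refl
        cases (no _) (no _) (no _) (no _) = refl
        cases (no _) (no _) (yes _) (yes _) = sym (ℕₚ.+-identityʳ (f u))
        cases (no _) (no _) (no noNeighbour) (yes (x , ux)) = ⊥-elim (noNeighbour (x , isolate-⊆ H ℓ ux))
        cases (no u≢r) (no u≢ℓ) (yes (x , ux)) (no noNeighbour) =
          ⊥-elim (noNeighbour (firstStep _ (Walk-isolatePendant pendant (rooted u x ux) u≢ℓ (ℓ≢r ∘ sym)) u≢r))

  module _ (H : Graph n) (edgeless : ∀ u v → ¬ Adj H u v) where

    arcSum-edgeless : ∀ h → arcSum H h ≡ 0
    arcSum-edgeless h = ∑-zero (λ u → ∑-zero (pointwise u))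
      where
      pointwise : ∀ u v → arcTerm H h u v ≡ 0
      pointwise u v with adj H u v in uv
      ... | false = refl
      ... | true  = ⊥-elim (edgeless u v (subst T (sym uv) _))

    childSum-edgeless : ∀ f → childSum H f ≡ 0
    childSum-edgeless f = ∑-zero pointwise
      where
      pointwise : ∀ u → childTerm H f u ≡ 0
      pointwise u with u Fin.≟ r | hasNeighbour? H u
      ... | yes _ | _            = refl
      ... | no _  | no _         = refl
      ... | no _  | yes (x , ux) = ⊥-elim (edgeless u x ux)

  rooted-induction : (P : Graph n → Set) →
    (∀ H → (∀ u v → ¬ Adj H u v) → P H) →
    (∀ {H ℓ p} → Rooted H → ℓ ≢ r → Pendant H ℓ p → P (isolate H ℓ) → P H) →
    ∀ {H} → Acyclic H → Rooted H → P H
  rooted-induction P P-edgeless P-isolate {H} acyclic rooted =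
    go (suc (arcSum H (λ _ _ → 1))) acyclic rooted (ℕₚ.n<1+n _)
    where
    -- recursion on the number of arcs, which isolating a pendant vertex lowers by two
    go : ∀ fuel {H} → Acyclic H → Rooted H → arcSum H (λ _ _ → 1) < fuel → P H
    go (suc fuel) {H} acyclic rooted bound with any? (λ w → T? (adj H r w))
    ... | no rIsolated = P-edgeless H noEdge
      where
      noEdge : ∀ u v → ¬ Adj H u v
      noEdge u v uv with u Fin.≟ r
      ... | yes refl = rIsolated (v , uv)
      ... | no u≢r with lastStep H (rooted u v uv) u≢r
      ...   | y , yr = rIsolated (y , Adj-sym H yr)
    ... | yes (w , rw) with pendant-exists H acyclic r rw
    ... | ℓ , p , ℓ≢r , ℓ-pendant =
      P-isolate rooted ℓ≢r ℓ-pendant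
        (go fuel {isolate H ℓ} (Acyclic-⊆ H {isolate H ℓ} (isolate-⊆ H ℓ) acyclic)
            (Rooted-isolatePendant rooted ℓ≢r ℓ-pendant) bound′)
      where
      a′ = arcSum (isolate H ℓ) (λ _ _ → 1)
      bound′ : a′ < fuel
      bound′ = ℕₚ.<-≤-trans (ℕₚ.m<m+n a′ (s≤s z≤n))
                 (ℕₚ.≤-trans (ℕₚ.m≤m+n (a′ + 1) 1)
                   (subst (_≤ fuel) (arcSum-isolatePendant ℓ-pendant (λ _ _ → 1)) (s≤s⁻¹ bound)))

  arcCount≡2*childCount : ∀ {H} → Acyclic H → Rooted H →
    arcSum H (λ _ _ → 1) ≡ childSum H (λ _ → 1) + childSum H (λ _ → 1)
  arcCount≡2*childCount {H} = rooted-induction P edgeless removeLeaf {H}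
    where
    P : Graph n → Set
    P H = arcSum H (λ _ _ → 1) ≡ childSum H (λ _ → 1) + childSum H (λ _ → 1)
    edgeless : ∀ H → (∀ u v → ¬ Adj H u v) → P H
    edgeless H noEdge = trans (arcSum-edgeless H noEdge (λ _ _ → 1))
      (sym (cong₂ _+_ (childSum-edgeless H noEdge (λ _ → 1)) (childSum-edgeless H noEdge (λ _ → 1))))
    removeLeaf : ∀ {H ℓ p} → Rooted H → ℓ ≢ r → Pendant H ℓ p → P (isolate H ℓ) → P H
    removeLeaf {H} {ℓ} rooted ℓ≢r pendant ih = begin
      arcSum H (λ _ _ → 1)                      ≡⟨ arcSum-isolatePendant pendant (λ _ _ → 1) ⟩
      arcSum (isolate H ℓ) (λ _ _ → 1) + 1 + 1  ≡⟨ cong (λ a → a + 1 + 1) ih ⟩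
      c′ + c′ + 1 + 1                           ≡⟨ regroup c′ ⟩
      (c′ + 1) + (c′ + 1)                       ≡⟨ sym (cong₂ _+_ c≡c′+1 c≡c′+1) ⟩
      childSum H (λ _ → 1) + childSum H (λ _ → 1) ∎
      where
      open ≡-Reasoning
      c′ = childSum (isolate H ℓ) (λ _ → 1)
      c≡c′+1 : childSum H (λ _ → 1) ≡ c′ + 1
      c≡c′+1 = childSum-isolatePendant rooted ℓ≢r pendant (λ _ → 1)
      regroup : ∀ c → c + c + 1 + 1 ≡ (c + 1) + (c + 1)
      regroup = solve-∀

  arcSum-⊓≤2*childSum : ∀ (g : Fin n → ℕ) {H} → Acyclic H → Rooted H →
    arcSum H (λ u v → g u ⊓ g v) ≤ childSum H g + childSum H g
  arcSum-⊓≤2*childSum g {H} = rooted-induction P edgeless removeLeaf {H}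
    where
    P : Graph n → Set
    P H = arcSum H (λ u v → g u ⊓ g v) ≤ childSum H g + childSum H g
    edgeless : ∀ H → (∀ u v → ¬ Adj H u v) → P H
    edgeless H noEdge =
      subst (_≤ childSum H g + childSum H g) (sym (arcSum-edgeless H noEdge (λ u v → g u ⊓ g v))) z≤n
    removeLeaf : ∀ {H ℓ p} → Rooted H → ℓ ≢ r → Pendant H ℓ p → P (isolate H ℓ) → P H
    removeLeaf {H} {ℓ} {p} rooted ℓ≢r pendant ih = begin
      arcSum H (λ u v → g u ⊓ g v)
        ≡⟨ arcSum-isolatePendant pendant (λ u v → g u ⊓ g v) ⟩
      arcSum (isolate H ℓ) (λ u v → g u ⊓ g v) + g ℓ ⊓ g p + g p ⊓ g ℓ
        ≤⟨ ℕₚ.+-mono-≤ (ℕₚ.+-mono-≤ ih (ℕₚ.m⊓n≤m (g ℓ) (g p))) (ℕₚ.m⊓n≤n (g p) (g ℓ)) ⟩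
      c′ + c′ + g ℓ + g ℓ
        ≡⟨ regroup c′ (g ℓ) ⟩
      (c′ + g ℓ) + (c′ + g ℓ)
        ≡⟨ sym (cong₂ _+_ c≡c′+gℓ c≡c′+gℓ) ⟩
      childSum H g + childSum H g ∎
      where
      open ℕₚ.≤-Reasoning
      c′ = childSum (isolate H ℓ) g
      c≡c′+gℓ : childSum H g ≡ c′ + g ℓ
      c≡c′+gℓ = childSum-isolatePendant rooted ℓ≢r pendant g
      regroup : ∀ c x → c + c + x + x ≡ (c + x) + (c + x)
      regroup = solve-∀

  childSum-connected : ∀ {H} → Connected H → ∀ f → childSum H f + f r ≡ sum f
  childSum-connected {H} connected f = begin
    childSum H f + f r                    ≡⟨ cong (_+_ (childSum H f)) (sym (∑-pointMass r (f r))) ⟩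
    childSum H f + sum (pointMass r (f r)) ≡⟨ sym (∑-distrib-+ (childTerm H f) (pointMass r (f r))) ⟩
    ∑[ u < n ] (childTerm H f u + pointMass r (f r) u) ≡⟨ sum-cong-≗ pointwise ⟩
    sum f                                 ∎
    where
    open ≡-Reasoning
    pointwise : ∀ u → childTerm H f u + pointMass r (f r) u ≡ f u
    pointwise u with u Fin.≟ r | hasNeighbour? H u
    ... | yes refl | _         = refl
    ... | no _     | yes _     = ℕₚ.+-identityʳ (f u)
    ... | no u≢r   | no isolated = ⊥-elim (isolated (firstStep H (connected u r) u≢r))

-- Trees

order≡size+1 : ∀ {k} (G : Graph (suc k)) → IsTree G → suc k ≡ suc (size G)
order≡size+1 {k} G (connected , acyclic) = begin
  suc k                 ≡⟨ sym (∑-one (suc k)) ⟩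
  ∑[ u < suc k ] 1      ≡⟨ sym (childSum-connected zero connected (λ _ → 1)) ⟩
  c + 1                 ≡⟨ cong (_+ 1) c≡size ⟩
  size G + 1            ≡⟨ ℕₚ.+-comm (size G) 1 ⟩
  suc (size G)          ∎
  where
  open ≡-Reasoning
  c = childSum zero G (λ _ → 1)
  c≡size : c ≡ size G
  c≡size = ℕₚ.*-cancelˡ-≡ c (size G) 2 (begin
    2 * c                     ≡⟨ cong (_+_ c) (ℕₚ.+-identityʳ c) ⟩
    c + c                     ≡⟨ sym (arcCount≡2*childCount zero acyclic (λ u _ _ → connected u zero)) ⟩
    arcSum G (λ _ _ → 1)      ≡⟨ sym (∑deg≡arcCount G) ⟩
    ∑[ u < suc k ] deg G u    ≡⟨ handshake G ⟩
    2 * size G                ∎)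

high-degree-vertex : ∀ {n} (G : Graph n) → 3 ≤ n → n ≡ suc (size G) → ∃ λ r → 2 ≤ deg G r
high-degree-vertex {n} G 3≤n n≡m+1 with any? (λ u → 2 ℕₚ.≤? deg G u)
... | yes found = found
... | no none = ⊥-elim (ℕₚ.<-irrefl refl (ℕₚ.+-cancelˡ-≤ m 2 1 (begin
  m + 2     ≤⟨ ℕₚ.+-monoʳ-≤ m (s≤s⁻¹ (subst (3 ≤_) n≡m+1 3≤n)) ⟩
  m + m     ≡⟨ cong (_+_ m) (sym (ℕₚ.+-identityʳ m)) ⟩
  2 * m     ≡⟨ sym (handshake G) ⟩
  ∑[ u < n ] deg G u ≤⟨ ∑-mono-≤ (λ u → ℕₚ.≤-pred (ℕₚ.≰⇒> (λ 2≤du → none (u , 2≤du)))) ⟩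
  ∑[ u < n ] 1       ≡⟨ trans (∑-one n) n≡m+1 ⟩
  suc m     ≡⟨ ℕₚ.+-comm 1 m ⟩
  m + 1     ∎)))
  where
  open ℕₚ.≤-Reasoning
  m = size G

[m+1]*[i+A]<[m+1]*i+[2m]² : ∀ m i A → A + 4 ≤ 4 * m → suc m * (i + A) < suc m * i + 2 * m * (2 * m)
[m+1]*[i+A]<[m+1]*i+[2m]² m i A A+4≤4m = begin-strict
  suc m * (i + A)             ≡⟨ ℕₚ.*-distribˡ-+ (suc m) i A ⟩
  suc m * i + suc m * A       <⟨ ℕₚ.+-monoʳ-< (suc m * i) (ℕₚ.+-cancelʳ-≤ (4 * m) _ _ bound) ⟩
  suc m * i + 2 * m * (2 * m) ∎
  where
  open ℕₚ.≤-Reasoning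
  expand₁ : ∀ m A → 4 + suc m * A + 4 * m ≡ suc m * (A + 4)
  expand₁ = solve-∀
  expand₂ : ∀ m → suc m * (4 * m) ≡ 2 * m * (2 * m) + 4 * m
  expand₂ = solve-∀
  bound : suc (suc m * A) + 4 * m ≤ 2 * m * (2 * m) + 4 * m
  bound = begin
    suc (suc m * A) + 4 * m   ≤⟨ ℕₚ.+-monoˡ-≤ (4 * m) (ℕₚ.+-monoˡ-≤ (suc m * A) (s≤s (z≤n {3}))) ⟩
    4 + suc m * A + 4 * m     ≡⟨ expand₁ m A ⟩
    suc m * (A + 4)           ≤⟨ ℕₚ.*-monoʳ-≤ (suc m) A+4≤4m ⟩
    suc m * (4 * m)           ≡⟨ expand₂ m ⟩
    2 * m * (2 * m) + 4 * m   ∎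

arcSum-⊓deg+4≤4*size : ∀ {n} (G : Graph n) → IsTree G → ∀ {r} → 2 ≤ deg G r →
  arcSum G (λ u v → deg G u ⊓ deg G v) + 4 ≤ 4 * size G
arcSum-⊓deg+4≤4*size G (connected , acyclic) {r} 2≤dr = begin
  arcSum G (λ u v → deg G u ⊓ deg G v) + 4
    ≤⟨ ℕₚ.+-monoˡ-≤ 4 (arcSum-⊓≤2*childSum r (deg G) acyclic (λ u _ _ → connected u r)) ⟩
  c + c + 4             ≡⟨ regroup c ⟩
  (c + 2) + (c + 2)     ≤⟨ ℕₚ.+-mono-≤ c+2≤2m c+2≤2m ⟩
  2 * m + 2 * m         ≡⟨ double m ⟩
  4 * m                 ∎
  where
  open ℕₚ.≤-Reasoning
  m = size G
  c = childSum r G (deg G)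
  c+2≤2m : c + 2 ≤ 2 * m
  c+2≤2m = subst (c + 2 ≤_) (trans (childSum-connected r connected (deg G)) (handshake G))
                 (ℕₚ.+-monoʳ-≤ c 2≤dr)
  regroup : ∀ c → c + c + 4 ≡ (c + 2) + (c + 2)
  regroup = solve-∀
  double : ∀ m → 2 * m + 2 * m ≡ 4 * m
  double = solve-∀

theorem1 : (n : ℕ) → 3 ≤ n → (T : Graph n) → IsTree T →
    (+ n / 1) ℚ.* Var T ℚ.< (+ irr T / 1)
theorem1 (suc k) 3≤n T tree =
  n*meanSqDeviation< k (deg T) (irr T) (handshake T) n*sumSq<n*irr+[2m]²
  where
  m = size T
  n≡m+1 : suc k ≡ suc m
  n≡m+1 = order≡size+1 T tree
  A = arcSum T (λ u v → deg T u ⊓ deg T v)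
  sumSq≡irr+A : ∑[ u < suc k ] (deg T u * deg T u) ≡ irr T + A
  sumSq≡irr+A = trans (∑deg²≡arcSum-deg T) (arcSum-deg≡irr+arcSum-⊓ T)
  A+4≤4m : A + 4 ≤ 4 * m
  A+4≤4m = arcSum-⊓deg+4≤4*size T tree (proj₂ (high-degree-vertex T 3≤n n≡m+1))
  n*sumSq<n*irr+[2m]² : suc k * ∑[ u < suc k ] (deg T u * deg T u) < suc k * irr T + 2 * m * (2 * m)
  n*sumSq<n*irr+[2m]² =
    subst₂ (λ N S → N * S < N * irr T + 2 * m * (2 * m)) (sym n≡m+1) (sym sumSq≡irr+A)
      ([m+1]*[i+A]<[m+1]*i+[2m]² m (irr T) A A+4≤4m)
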